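{- Let $\varphi=\forall\pi_1\cdots\forall\pi_n.\psi$ be a universally quantified HyperTSL formula, let $T_P$ and $T_U$ be the sets of predicate terms and update terms occurring in $\varphi$, and let $AP_{in}=\{a_\tau:\tau\in T_P\}$, $AP_{out}=\{a_u:u\in T_U\}$. If the HyperLTL formula $\mathrm{transl}(\varphi)$ over $AP_{in}\,\dot\cup\,AP_{out}$ is realizable, then $\varphi$ is realizable.
   Context: TSL setting. Let $\mathcal V$ be a set of values containing the Booleans $\mathbb B$. Fix a set $\mathbb I$ of inputs, a finite set $\mathbb C$ of cells, function symbols $\Sigma_F$ (with arities) and predicate symbols $\Sigma_P\subseteq\Sigma_F$. Function terms: $\tau::=s\mid f\,\tau_1\cdots\tau_n$, $s\in\mathbb I\cup\mathbb C$, $f\in\Sigma_F$ $n$-ary; $\mathcal T_F$ is their set. Predicate terms: $p\,\tau_1\cdots\tau_n$, $p\in\Sigma_P$. Update terms: $[c\leftarrow\tau]$, $c\in\mathbb C$. An interpretation $\langle\cdot\rangle$ maps each $n$-ary symbol to a function $\mathcal V^n\to\mathcal V$ (predicate symbols to maps into $\mathbb B$). Cell assignments are total maps $\mathbb C\to\mathcal T_F$, forming the set $\mathcal C$; computations are $\varsigma\in\mathcal C^\omega$; input streams are $\iota\in\mathcal I^\omega$, $\mathcal I$ the set of maps $\mathbb I\to\mathcal V$; executions are pairs $(\varsigma,\iota)$. Each cell $c$ has an initial value $\mathrm{init}_c$. Evaluation: $\eta(\varsigma,\iota,i,s)=\iota(i)(s)$ for $s\in\mathbb I$; $=\mathrm{init}_s$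 for $s\in\mathbb C$, $i=0$; $=\eta(\varsigma,\iota,i-1,\varsigma(i-1)(s))$ for $s\in\mathbb C$, $i>0$; $\eta(\varsigma,\iota,i,f\tau_1\cdots\tau_n)=\langle f\rangle(\eta(\varsigma,\iota,i,\tau_1),\dots)$. HyperTSL: $\varphi::=\forall\pi.\varphi\mid\exists\pi.\varphi\mid\psi$, $\psi::=\neg\psi\mid\psi\wedge\psi\mid X\psi\mid\psi U\psi\mid(\tau^p)_\pi\mid[c\leftarrow\tau]_\pi$. Over a set $E$ of executions, assignment $\Pi$ of trace variables to $E$, interpretation and time $i$: $[c\leftarrow\tau]_\pi$ holds iff $\varsigma(i)(c)$ is syntactically $\tau$ for $(\varsigma,\iota)=\Pi(\pi)$; $(\tau^p)_\pi$ holds iff $\eta(\varsigma,\iota,i,\tau^p)$ is true; Boolean and temporal operators as in LTL ($X$: next step; $U$: until); quantifiers range over $E$. $E\models_{\langle\cdot\rangle}\varphi$ iff $\varphi$ holds at time $0$ with empty assignment. HyperTSL realizability: a strategy is $\sigma:(2^{T_P})^+\to\mathcal C$; for an interpretation and input stream $\iota$, the computation $\sigma(\iota)$ is given by $\sigma(\iota)(i)=\sigma(P_0\cdots P_i)$ with $P_j=\{\tau\in T_P:\eta(\sigma(\iota),\iota,j,\tau)\text{ true}\}$ (well defined since $\eta$ at time $j$ depends only on $\sigma(\iota)(0..j-1)$). $\varphi$ is realizable iff some strategy $\sigma$ satisfies $\{(\sigma(\iota),\iota):\iota\in\mathcal I^\omega\}\models_{\langle\cdot\rangle}\varphi$ for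 every interpretation $\langle\cdot\rangle$. HyperLTL: over $AP$, traces in $(2^{AP})^\omega$, formulas $\forall\pi/\exists\pi$ prefixes over LTL bodies with atoms $a_\pi$ ($a\in\Pi(\pi)(i)$); $T\models\varphi$ for a trace set $T$ as usual. With $AP=AP_{in}\dot\cup AP_{out}$, a HyperLTL strategy is $\sigma:(2^{AP_{in}})^+\to 2^{AP_{out}}$, $\mathit{traces}(\sigma)=\{(w_0\cup\sigma(w_0))(w_1\cup\sigma(w_0w_1))\cdots : w\in(2^{AP_{in}})^\omega\}$; a HyperLTL formula is realizable iff some strategy has $\mathit{traces}(\sigma)\models\varphi$. Translation: for each term $\tau\in T_P\cup T_U$ a fresh proposition $a_\tau$. With $T_U^c$ the update terms of $T_U$ for cell $c$, $\mathit{cellProps}_\pi:=G\bigwedge_{c\in\mathbb C}\bigvee_{u\in T_U^c}((a_u)_\pi\wedge\bigwedge_{u'\in T_U^c\setminus\{u\}}\neg(a_{u'})_\pi)$ ($G$ = globally). For $\varphi=Q_1\pi_1\cdots Q_n\pi_n.\psi$, $\mathrm{transl}(\varphi)=Q_1\pi_1\cdots Q_n\pi_n.\psi'\wedge\bigwedge_j\mathit{cellProps}_{\pi_j}$ where $\psi'$ replaces each $(\tau)_\pi$ by $(a_\tau)_\pi$. -}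

module Defs where

open import Data.Nat using (ℕ; zero; suc; _≤_; _<_)
open import Data.Bool using (Bool; true; false; T)
open import Data.Fin using (Fin; zero; suc; toℕ)
open import Data.Fin.Properties using () renaming (_≟_ to _≟ᶠ_)
open import Data.Vec using (Vec; []; _∷_; _∷ʳ_; lookup; tabulate)
open import Data.List using (List; []; _∷_; _++_; length; filter; foldr)
open import Data.List.Membership.Propositional using (_∈_)
open import Data.List.Membership.Propositional.Properties using (∈-++⁺ˡ; ∈-++⁺ʳ)
open import Data.List.Relation.Unary.Any using (here; index)
open import Data.List.Base using (allFin)
open import Data.Product using (Σ; _×_; _,_; proj₁; proj₂)
open import Data.Sum using (_⊎_; inj₁; inj₂; [_,_])
open import Relation.Binary.PropositionalEquality using (_≡_; _≢_; refl)
open import Relation.Nullary using (¬_)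
open import Data.Unit using (⊤)
open import Relation.Nullary.Decidable using (¬?)
open import Function using (_∘_; const)

module LTL (AP : Set) where

  -- bodies with n (de Bruijn) trace variables
  data LBody (n : ℕ) : Set where
    tt   : LBody n
    atom : AP → Fin n → LBody n
    neg  : LBody n → LBody n
    and  : LBody n → LBody n → LBody n
    X    : LBody n → LBody n
    U    : LBody n → LBody n → LBody n

  ff : ∀ {n} → LBody n
  ff = neg tt

  or : ∀ {n} → LBody n → LBody n → LBody n
  or a b = neg (and (neg a) (neg b))

  G : ∀ {n} → LBody n → LBody n
  G a = neg (U tt (neg a))

  ⋀ : ∀ {n} → List (LBody n) → LBody n
  ⋀ = foldr and tt

  ⋁ : ∀ {n} → List (LBody n) → LBody n
  ⋁ = foldr or ff

  data LForm : ℕ → Set where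
    body : ∀ {n} → LBody n → LForm n
    all  : ∀ {n} → LForm (suc n) → LForm n
    ex   : ∀ {n} → LForm (suc n) → LForm n

  Trace : Set
  Trace = ℕ → AP → Bool

  ext : ∀ {A : Set} {n} → A → (Fin n → A) → Fin (suc n) → A
  ext a Π zero = a
  ext a Π (suc k) = Π k

  ⟦_⟧B : ∀ {n} → LBody n → (Fin n → Trace) → ℕ → Set
  ⟦ tt ⟧B Π i = ⊤
  ⟦ atom a π ⟧B Π i = Π π i a ≡ true
  ⟦ neg ψ ⟧B Π i = ¬ ⟦ ψ ⟧B Π i
  ⟦ and ψ₁ ψ₂ ⟧B Π i = ⟦ ψ₁ ⟧B Π i × ⟦ ψ₂ ⟧B Π i
  ⟦ X ψ ⟧B Π i = ⟦ ψ ⟧B Π (suc i)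
  ⟦ U ψ₁ ψ₂ ⟧B Π i =
    Σ ℕ λ k → i ≤ k × ⟦ ψ₂ ⟧B Π k × (∀ j → i ≤ j → j < k → ⟦ ψ₁ ⟧B Π j)

  -- a set of traces is given as the image { el x | x : Ix }
  ⟦_⟧F : ∀ {n} → LForm n → (Ix : Set) → (Ix → Trace) → (Fin n → Trace) → Set
  ⟦ body ψ ⟧F Ix el Π = ⟦ ψ ⟧B Π 0
  ⟦ all φ ⟧F Ix el Π = (x : Ix) → ⟦ φ ⟧F Ix el (ext (el x) Π)
  ⟦ ex φ ⟧F Ix el Π = Σ Ix λ x → ⟦ φ ⟧F Ix el (ext (el x) Π)

  _⊨_ : (Σ Set λ Ix → Ix → Trace) → LForm 0 → Set
  (Ix , el) ⊨ φ = ⟦ φ ⟧F Ix el (λ ())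

module LTLReal (APin APout : Set) where
  open LTL (APin ⊎ APout) public

  -- σ : (2^{APin})^+ → 2^{APout}; a word of length n+1 is a Vec of length suc n
  LStrat : Set
  LStrat = (n : ℕ) → Vec (APin → Bool) (suc n) → (APout → Bool)

  prefix : (ℕ → APin → Bool) → (n : ℕ) → Vec (APin → Bool) (suc n)
  prefix w n = tabulate (λ k → w (toℕ k))

  traceOf : LStrat → (ℕ → APin → Bool) → Trace
  traceOf σ w i (inj₁ a) = w i a
  traceOf σ w i (inj₂ b) = σ i (prefix w i) b

  LRealizable : LForm 0 → Set
  LRealizable φ = Σ LStrat λ σ → ((ℕ → APin → Bool) , traceOf σ) ⊨ φ

record Setting : Set₁ where
  field
    V       : Set
    vtrue   : V                   -- the Booleans 𝔹 ⊆ V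
    vfalse  : V
    vt≢vf   : vtrue ≢ vfalse
    In      : Set
    nCells  : ℕ
    Fun     : Set
    arity   : Fun → ℕ
    isPred  : Fun → Bool          -- Σ_P = { f | isPred f ≡ true } ⊆ Σ_F
    init    : Fin nCells → V

module TSL (S : Setting) where
  open Setting S

  Cell : Set
  Cell = Fin nCells

  data FTerm : Set where
    inp : In → FTerm
    cel : Cell → FTerm
    app : (f : Fun) → Vec FTerm (arity f) → FTerm

  record PTerm : Set where
    constructor ptm
    field
      sym  : Fun
      isP  : T (isPred sym)
      args : Vec FTerm (arity sym)

  UTerm : Set
  UTerm = Cell × FTerm

  Assign : Set
  Assign = Cell → FTerm

  Input : Set
  Input = In → V

  Exec : Set
  Exec = (ℕ → Assign) × (ℕ → Input)

  record Interp : Set where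
    field
      fn       : (f : Fun) → Vec V (arity f) → V
      predBool : ∀ f → T (isPred f) → ∀ xs → fn f xs ≡ vtrue ⊎ fn f xs ≡ vfalse
  open Interp public

  -- Evaluation η at time i, given the history ς(i-1), …, ς(0) (most recent first)
  mutual
    evalH : Interp → (ℕ → Input) → (i : ℕ) → Vec Assign i → FTerm → V
    evalH I ι i h (inp s) = ι i s
    evalH I ι zero [] (cel c) = init c
    evalH I ι (suc i) (a ∷ h) (cel c) = evalH I ι i h (a c)
    evalH I ι i h (app f ts) = fn I f (evalsH I ι i h ts)

    evalsH : ∀ {m} → Interp → (ℕ → Input) → (i : ℕ) → Vec Assign i → Vec FTerm m → Vec V m
    evalsH I ι i h [] = []
    evalsH I ι i h (t ∷ ts) = evalH I ι i h t ∷ evalsH I ι i h ts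

  hist : (ℕ → Assign) → (i : ℕ) → Vec Assign i
  hist ς zero = []
  hist ς (suc i) = ς i ∷ hist ς i

  η : Interp → Exec → ℕ → FTerm → V
  η I (ς , ι) i τ = evalH I ι i (hist ς i) τ

  ηP : Interp → Exec → ℕ → PTerm → V
  ηP I e i (ptm p _ ts) = fn I p (Data.Vec.map (η I e i) ts)

  data TBody (n : ℕ) : Set where
    atomP : PTerm → Fin n → TBody n
    atomU : UTerm → Fin n → TBody n
    neg   : TBody n → TBody n
    and   : TBody n → TBody n → TBody n
    X     : TBody n → TBody n
    U     : TBody n → TBody n → TBody n

  data TForm : ℕ → Set where
    body : ∀ {n} → TBody n → TForm n
    all  : ∀ {n} → TForm (suc n) → TForm n
    ex   : ∀ {n} → TForm (suc n) → TForm n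

  data Universal : ∀ {n} → TForm n → Set where
    body : ∀ {n} (ψ : TBody n) → Universal (body ψ)
    all  : ∀ {n} {φ : TForm (suc n)} → Universal φ → Universal (all φ)

  ext : ∀ {A : Set} {n} → A → (Fin n → A) → Fin (suc n) → A
  ext a Π zero = a
  ext a Π (suc k) = Π k

  ⟦_⟧B : ∀ {n} → TBody n → Interp → (Fin n → Exec) → ℕ → Set
  ⟦ atomP τ π ⟧B I Π i = ηP I (Π π) i τ ≡ vtrue
  ⟦ atomU (c , τ) π ⟧B I Π i = proj₁ (Π π) i c ≡ τ
  ⟦ neg ψ ⟧B I Π i = ¬ ⟦ ψ ⟧B I Π i
  ⟦ and ψ₁ ψ₂ ⟧B I Π i = ⟦ ψ₁ ⟧B I Π i × ⟦ ψ₂ ⟧B I Π i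
  ⟦ X ψ ⟧B I Π i = ⟦ ψ ⟧B I Π (suc i)
  ⟦ U ψ₁ ψ₂ ⟧B I Π i =
    Σ ℕ λ k → i ≤ k × ⟦ ψ₂ ⟧B I Π k × (∀ j → i ≤ j → j < k → ⟦ ψ₁ ⟧B I Π j)

  -- a set E of executions is given as the image { el x | x : Ix }
  ⟦_⟧F : ∀ {n} → TForm n → Interp → (Ix : Set) → (Ix → Exec) → (Fin n → Exec) → Set
  ⟦ body ψ ⟧F I Ix el Π = ⟦ ψ ⟧B I Π 0
  ⟦ all φ ⟧F I Ix el Π = (x : Ix) → ⟦ φ ⟧F I Ix el (ext (el x) Π)
  ⟦ ex φ ⟧F I Ix el Π = Σ Ix λ x → ⟦ φ ⟧F I Ix el (ext (el x) Π)

  Models : (Σ Set λ Ix → Ix → Exec) → Interp → TForm 0 → Set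
  Models (Ix , el) I φ = ⟦ φ ⟧F I Ix el (λ ())

  atomsPB : ∀ {n} → TBody n → List PTerm
  atomsPB (atomP τ _) = τ ∷ []
  atomsPB (atomU _ _) = []
  atomsPB (neg ψ) = atomsPB ψ
  atomsPB (and a b) = atomsPB a ++ atomsPB b
  atomsPB (X ψ) = atomsPB ψ
  atomsPB (U a b) = atomsPB a ++ atomsPB b

  atomsUB : ∀ {n} → TBody n → List UTerm
  atomsUB (atomP _ _) = []
  atomsUB (atomU u _) = u ∷ []
  atomsUB (neg ψ) = atomsUB ψ
  atomsUB (and a b) = atomsUB a ++ atomsUB b
  atomsUB (X ψ) = atomsUB ψ
  atomsUB (U a b) = atomsUB a ++ atomsUB b

  atomsP : ∀ {n} → TForm n → List PTerm
  atomsP (body ψ) = atomsPB ψ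
  atomsP (all φ) = atomsP φ
  atomsP (ex φ) = atomsP φ

  atomsU : ∀ {n} → TForm n → List UTerm
  atomsU (body ψ) = atomsUB ψ
  atomsU (all φ) = atomsU φ
  atomsU (ex φ) = atomsU φ

  -- Realizability, w.r.t. a duplicate-free enumeration tp of T_P:
  -- 2^{T_P} is represented as Fin (length tp) → Bool
  module Real (tp : List PTerm) where
    Letter : Set
    Letter = Fin (length tp) → Bool

    TStrat : Set
    TStrat = (n : ℕ) → Vec Letter (suc n) → Assign

    pval : Interp → (ℕ → Input) → (i : ℕ) → Vec Assign i → PTerm → Bool
    pval I ι i h (ptm p isp ts) =
      [ const true , const false ] (predBool I p isp (evalsH I ι i h ts))

    letterAt : Interp → (ℕ → Input) → (i : ℕ) → Vec Assign i → Letter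
    letterAt I ι i h k = pval I ι i h (Data.List.lookup tp k)

    letters : Interp → (ℕ → Input) → (i : ℕ) → Vec Assign i → Vec Letter (suc i)
    letters I ι zero [] = letterAt I ι zero [] ∷ []
    letters I ι (suc i) (a ∷ h) = letters I ι i h ∷ʳ letterAt I ι (suc i) (a ∷ h)

    -- σ(ι)(n-1), …, σ(ι)(0)
    run : TStrat → Interp → (ℕ → Input) → (n : ℕ) → Vec Assign n
    run σ I ι zero = []
    run σ I ι (suc n) = σ n (letters I ι n (run σ I ι n)) ∷ run σ I ι n

    comp : TStrat → Interp → (ℕ → Input) → ℕ → Assign
    comp σ I ι i = σ i (letters I ι i (run σ I ι i))

    TRealizable : TForm 0 → Set
    TRealizable φ = Σ TStrat λ σ → (I : Interp) →
      Models ((ℕ → Input) , (λ ι → comp σ I ι , ι)) I φ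

  -- The translation, w.r.t. duplicate-free enumerations tp of T_P, tu of T_U.
  -- a_τ for τ = tp[k] is inj₁ k, a_u for u = tu[k] is inj₂ k.
  module Transl (tp : List PTerm) (tu : List UTerm) where
    open LTL (Fin (length tp) ⊎ Fin (length tu))
      renaming (neg to ¬ₗ; and to ∧ₗ; X to Xₗ; U to Uₗ; body to bodyₗ; all to allₗ; ex to exₗ)

    translB : ∀ {n} (ψ : TBody n) →
              (∀ {τ} → τ ∈ atomsPB ψ → τ ∈ tp) →
              (∀ {u} → u ∈ atomsUB ψ → u ∈ tu) → LBody n
    translB (atomP τ π) hp hu = atom (inj₁ (index (hp (here refl)))) π
    translB (atomU u π) hp hu = atom (inj₂ (index (hu (here refl)))) π
    translB (neg ψ) hp hu = ¬ₗ (translB ψ hp hu)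
    translB (and a b) hp hu =
      ∧ₗ (translB a (hp ∘ ∈-++⁺ˡ) (hu ∘ ∈-++⁺ˡ))
         (translB b (hp ∘ ∈-++⁺ʳ (atomsPB a)) (hu ∘ ∈-++⁺ʳ (atomsUB a)))
    translB (X ψ) hp hu = Xₗ (translB ψ hp hu)
    translB (U a b) hp hu =
      Uₗ (translB a (hp ∘ ∈-++⁺ˡ) (hu ∘ ∈-++⁺ˡ))
         (translB b (hp ∘ ∈-++⁺ʳ (atomsPB a)) (hu ∘ ∈-++⁺ʳ (atomsUB a)))

    TUc : Cell → List (Fin (length tu))
    TUc c = filter (λ k → proj₁ (Data.List.lookup tu k) ≟ᶠ c) (allFin (length tu))

    exactlyOne : ∀ {n} → Cell → Fin n → LBody n
    exactlyOne c π = ⋁ (Data.List.map (λ k →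
      ∧ₗ (atom (inj₂ k) π)
         (⋀ (Data.List.map (λ k' → ¬ₗ (atom (inj₂ k') π))
               (filter (λ k' → ¬? (k' ≟ᶠ k)) (TUc c)))))
      (TUc c))

    cellProps : ∀ {n} → Fin n → LBody n
    cellProps π = G (⋀ (Data.List.map (λ c → exactlyOne c π) (allFin nCells)))

    transl : ∀ {n} (φ : TForm n) →
             (∀ {τ} → τ ∈ atomsP φ → τ ∈ tp) →
             (∀ {u} → u ∈ atomsU φ → u ∈ tu) → LForm n
    transl {n} (body ψ) hp hu =
      bodyₗ (∧ₗ (translB ψ hp hu) (⋀ (Data.List.map cellProps (allFin n))))
    transl (all φ) hp hu = allₗ (transl φ hp hu)
    transl (ex φ) hp hu = exₗ (transl φ hp hu)

-- A HyperLTL strategy for transl(φ) reads the truth values of the predicate terms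
-- (the propositions a_τ) and outputs a valuation of the propositions a_u; the
-- conjuncts cellProps force this valuation to make exactly one update term true
-- per cell on every trace. The TSL strategy performs, for each cell, the update
-- whose proposition is true. Both strategies then see the same inputs at every
-- step, so along corresponding traces each atom (τ)_π holds iff a_τ does and
-- [c ← τ]_π holds iff a_[c←τ] does; by induction on ψ the body of φ holds on
-- tuples of executions iff its translation holds on the corresponding traces, and
-- since φ has only universal quantifiers this transfers transl(φ) to φ.
module Submission where

open import Defs
open import Data.List using (List; length)
open import Data.Fin using (Fin)
open import Data.List.Membership.Propositional using (_∈_)
open import Data.List.Relation.Unary.Unique.Propositional using (Unique)

open import Data.Bool using (Bool; true; false; T)
open import Data.Empty using (⊥-elim)
open import Data.Fin using (zero; suc; toℕ)
open import Data.Fin.Properties using () renaming (_≟_ to _≟ᶠ_)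
open import Data.List using ([]; _∷_; filter; allFin; findᵇ; map; lookup)
open import Data.List.Membership.Propositional.Properties
  using (∈-filter⁺; ∈-filter⁻; ∈-allFin; ∈-lookup)
open import Data.List.Relation.Unary.All as All using ()
open import Data.List.Relation.Unary.AllPairs using (_∷_)
open import Data.List.Relation.Unary.Any using (here; there)
open import Data.List.Relation.Unary.Any.Properties using (lookup-index)
open import Data.Maybe using (just; nothing; maybe)
open import Data.Nat using (ℕ; zero; suc; _≤_; _<_; z≤n)
open import Data.Product using (Σ; _×_; _,_; proj₁; proj₂)
open import Data.Product.Function.NonDependent.Propositional using (_×-⇔_)
open import Data.Sum using (_⊎_; inj₁; inj₂)
open import Data.Unit using (tt)
open import Data.Vec using (Vec; []; _∷_; _∷ʳ_; tabulate)
import Data.Vec as Vec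
open import Function using (_∘_)
open import Function.Bundles using (_⇔_; mk⇔; Equivalence)
open import Function.Related.TypeIsomorphisms using (¬-cong-⇔)
open import Relation.Binary.PropositionalEquality
open import Relation.Nullary using (¬_; ¬?)
open import Relation.Nullary.Decidable using (decidable-stable)

open Equivalence using (to; from)

true≢false : true ≢ false
true≢false ()

lookup-injective : ∀ {A : Set} {xs : List A} → Unique xs → (i j : Fin (length xs)) →
                   lookup xs i ≡ lookup xs j → i ≡ j
lookup-injective (_ ∷ _) zero zero _ = refl
lookup-injective (x∉ ∷ _) zero (suc j) eq = ⊥-elim (All.lookup x∉ (∈-lookup j) eq)
lookup-injective (x∉ ∷ _) (suc i) zero eq = ⊥-elim (All.lookup x∉ (∈-lookup i) (sym eq))
lookup-injective (_ ∷ xs!) (suc i) (suc j) eq = cong suc (lookup-injective xs! i j eq)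

tabulate-suc : ∀ {A : Set} (n : ℕ) (g : ℕ → A) →
               tabulate {n = suc n} (g ∘ toℕ) ≡ tabulate {n = n} (g ∘ toℕ) ∷ʳ g n
tabulate-suc zero g = refl
tabulate-suc (suc n) g = cong (g 0 ∷_) (tabulate-suc n (g ∘ suc))

module _ {A : Set} (b : A → Bool) where

  findᵇ-just⁻ : ∀ {x} xs → findᵇ b xs ≡ just x → x ∈ xs × b x ≡ true
  findᵇ-just⁻ (y ∷ xs) eq with b y in by
  findᵇ-just⁻ (y ∷ xs) refl | true = here refl , by
  ... | false = let x∈xs , bx = findᵇ-just⁻ xs eq in there x∈xs , bx

  findᵇ-nothing⁻ : ∀ {x} xs → findᵇ b xs ≡ nothing → x ∈ xs → b x ≡ false
  findᵇ-nothing⁻ (y ∷ xs) eq x∈ with b y in by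
  findᵇ-nothing⁻ (y ∷ xs) () x∈ | true
  findᵇ-nothing⁻ (y ∷ xs) eq (here refl) | false = by
  findᵇ-nothing⁻ (y ∷ xs) eq (there x∈xs) | false = findᵇ-nothing⁻ xs eq x∈xs

  record ExactlyOneTrue (xs : List A) : Set where
    field
      ¬none : ¬ (∀ {x} → x ∈ xs → b x ≡ false)
      unique : ∀ {x y} → x ∈ xs → y ∈ xs → b x ≡ true → b y ≡ true → x ≡ y

  findᵇ-exactlyOne : ∀ {x xs} → ExactlyOneTrue xs → x ∈ xs → b x ≡ true →
                     findᵇ b xs ≡ just x
  findᵇ-exactlyOne {x} {xs} one x∈xs bx with findᵇ b xs in found
  ... | just y = let y∈xs , by = findᵇ-just⁻ xs found in
                 cong just (ExactlyOneTrue.unique one y∈xs x∈xs by bx)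
  ... | nothing = ⊥-elim (true≢false (trans (sym bx) (findᵇ-nothing⁻ xs found x∈xs)))

until-cong : ∀ {A A′ B B′ : ℕ → Set} → (∀ j → A j ⇔ A′ j) → (∀ j → B j ⇔ B′ j) → ∀ i →
             (Σ ℕ λ k → i ≤ k × B k × (∀ j → i ≤ j → j < k → A j)) ⇔
             (Σ ℕ λ k → i ≤ k × B′ k × (∀ j → i ≤ j → j < k → A′ j))
until-cong A⇔A′ B⇔B′ i = mk⇔
  (λ (k , i≤k , bk , as) → k , i≤k , to (B⇔B′ k) bk , λ j i≤j j<k → to (A⇔A′ j) (as j i≤j j<k))
  (λ (k , i≤k , bk , as) → k , i≤k , from (B⇔B′ k) bk , λ j i≤j j<k → from (A⇔A′ j) (as j i≤j j<k))

module LTLProperties (AP : Set) where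
  open LTL AP

  ⋀-map⁻ : ∀ {n} {A : Set} (f : A → LBody n) xs {Π i} →
           ⟦ ⋀ (map f xs) ⟧B Π i → ∀ {x} → x ∈ xs → ⟦ f x ⟧B Π i
  ⋀-map⁻ f (y ∷ xs) (fy , _) (here refl) = fy
  ⋀-map⁻ f (y ∷ xs) (_ , rest) (there x∈xs) = ⋀-map⁻ f xs rest x∈xs

  ⋁-map⁻ : ∀ {n} {A : Set} (f : A → LBody n) xs {Π i} →
           ⟦ ⋁ (map f xs) ⟧B Π i → ¬ (∀ {x} → x ∈ xs → ¬ ⟦ f x ⟧B Π i)
  ⋁-map⁻ f [] ⋁xs _ = ⋁xs tt
  ⋁-map⁻ f (y ∷ xs) ⋁yxs none =
    ⋁yxs (none (here refl) , λ ⋁xs → ⋁-map⁻ f xs ⋁xs (none ∘ there))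

  G⁻ : ∀ {n} (ψ : LBody n) {Π i} → ⟦ G ψ ⟧B Π i → ∀ {j} → i ≤ j → ¬ ¬ ⟦ ψ ⟧B Π j
  G⁻ ψ Gψ {j} i≤j ¬ψ = Gψ (j , i≤j , ¬ψ , λ _ _ _ → tt)

module Runs (S : Setting) (tp : List (TSL.PTerm S)) where
  open Setting S
  open TSL S
  open Real tp

  map-evalH : ∀ I ι i h {m} (ts : Vec FTerm m) → Vec.map (evalH I ι i h) ts ≡ evalsH I ι i h ts
  map-evalH I ι i h [] = refl
  map-evalH I ι i h (t ∷ ts) = cong (_ ∷_) (map-evalH I ι i h ts)

  module _ (σ : TStrat) (I : Interp) (ι : ℕ → Input) where

    execution : Exec
    execution = comp σ I ι , ι

    letterStream : ℕ → Letter
    letterStream i = letterAt I ι i (run σ I ι i)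

    hist-comp : ∀ i → hist (comp σ I ι) i ≡ run σ I ι i
    hist-comp zero = refl
    hist-comp (suc i) = cong (comp σ I ι i ∷_) (hist-comp i)

    letters-run : ∀ i → letters I ι i (run σ I ι i) ≡ tabulate (letterStream ∘ toℕ)
    letters-run zero = refl
    letters-run (suc i) = begin
      letters I ι i (run σ I ι i) ∷ʳ letterStream (suc i)
        ≡⟨ cong (_∷ʳ letterStream (suc i)) (letters-run i) ⟩
      tabulate (letterStream ∘ toℕ) ∷ʳ letterStream (suc i)
        ≡⟨ tabulate-suc (suc i) letterStream ⟨
      tabulate (letterStream ∘ toℕ) ∎
      where open ≡-Reasoning

    ηP-execution : ∀ i p (isp : T (isPred p)) ts →
                   ηP I execution i (ptm p isp ts) ≡ fn I p (evalsH I ι i (run σ I ι i) ts)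
    ηP-execution i p isp ts = cong (fn I p) (begin
      Vec.map (evalH I ι i (hist (comp σ I ι) i)) ts ≡⟨ map-evalH I ι i _ ts ⟩
      evalsH I ι i (hist (comp σ I ι) i) ts          ≡⟨ cong (λ h → evalsH I ι i h ts) (hist-comp i) ⟩
      evalsH I ι i (run σ I ι i) ts                  ∎)
      where open ≡-Reasoning

    letterStream-true⇔ : ∀ i k → letterStream i k ≡ true ⇔ ηP I execution i (lookup tp k) ≡ vtrue
    letterStream-true⇔ i k with lookup tp k
    ... | ptm p isp ts with predBool I p isp (evalsH I ι i (run σ I ι i) ts)
    ...   | inj₁ isTrue = mk⇔ (λ _ → trans (ηP-execution i p isp ts) isTrue) (λ _ → refl)
    ...   | inj₂ isFalse = mk⇔ (λ ())
                                (λ isTrue → ⊥-elim (vt≢vf (trans (sym isTrue)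
                                  (trans (ηP-execution i p isp ts) isFalse))))

module Translation (S : Setting) (tp : List (TSL.PTerm S)) (tu : List (TSL.UTerm S))
                   (tu! : Unique tu) where
  open Setting S
  open TSL S
  open Real tp
  open Transl tp tu
  open Runs S tp
  module L = LTLReal (Fin (length tp)) (Fin (length tu))
  open LTLProperties (Fin (length tp) ⊎ Fin (length tu))

  updateOf : L.Trace → ℕ → Fin (length tu) → Bool
  updateOf tr i k = tr i (inj₂ k)

  WellFormed : L.Trace → Set
  WellFormed tr = ∀ i c → ExactlyOneTrue (updateOf tr i) (TUc c)

  ∈-TUc⁺ : ∀ {k c} → proj₁ (lookup tu k) ≡ c → k ∈ TUc c
  ∈-TUc⁺ {k} {c} = ∈-filter⁺ (λ k → proj₁ (lookup tu k) ≟ᶠ c) (∈-allFin k)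

  ∈-TUc⁻ : ∀ {k c} → k ∈ TUc c → proj₁ (lookup tu k) ≡ c
  ∈-TUc⁻ {k} {c} = proj₂ ∘ ∈-filter⁻ (λ k → proj₁ (lookup tu k) ≟ᶠ c) {xs = allFin _}

  exactlyOne⁻ : ∀ {n} {Π : Fin n → L.Trace} {π i} c →
                ¬ ¬ L.⟦ exactlyOne c π ⟧B Π i → ExactlyOneTrue (updateOf (Π π) i) (TUc c)
  exactlyOne⁻ {n} {Π} {π} {i} c ¬¬one = record { ¬none = ¬none ; unique = unique }
    where
    b : Fin (length tu) → Bool
    b = updateOf (Π π) i

    true⇒chosen : ∀ {j k} → L.⟦ L.⋀ (map (λ k′ → L.neg (L.atom (inj₂ k′) π))
                                          (filter (λ k′ → ¬? (k′ ≟ᶠ j)) (TUc c))) ⟧B Π i →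
                  k ∈ TUc c → b k ≡ true → k ≡ j
    true⇒chosen {j} {k} othersFalse k∈ bk = decidable-stable (k ≟ᶠ j) λ k≢j →
      ⋀-map⁻ _ (filter (λ k′ → ¬? (k′ ≟ᶠ j)) (TUc c)) othersFalse
        (∈-filter⁺ (λ k′ → ¬? (k′ ≟ᶠ j)) k∈ k≢j) bk

    ¬none : ¬ (∀ {k} → k ∈ TUc c → b k ≡ false)
    ¬none none = ¬¬one λ one →
      ⋁-map⁻ _ (TUc c) one λ k∈ (bk , _) → true≢false (trans (sym bk) (none k∈))

    unique : ∀ {k k′} → k ∈ TUc c → k′ ∈ TUc c → b k ≡ true → b k′ ≡ true → k ≡ k′
    unique {k} {k′} k∈ k′∈ bk bk′ = decidable-stable (k ≟ᶠ k′) λ k≢k′ → ¬¬one λ one →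
      ⋁-map⁻ _ (TUc c) one λ _ (_ , othersFalse) →
        k≢k′ (trans (true⇒chosen othersFalse k∈ bk) (sym (true⇒chosen othersFalse k′∈ bk′)))

  cellProps⇒wellFormed : ∀ {n} {Π : Fin n → L.Trace} π →
                         L.⟦ cellProps π ⟧B Π 0 → WellFormed (Π π)
  cellProps⇒wellFormed {Π = Π} π always i c = exactlyOne⁻ {Π = Π} c λ ¬one →
    G⁻ (L.⋀ (map (λ c → exactlyOne c π) (allFin nCells))) always z≤n λ all →
      ¬one (⋀-map⁻ (λ c → exactlyOne c π) (allFin nCells) all (∈-allFin c))

  -- When no update of c is selected the cell keeps its value, but well-formed
  -- traces never reach that default.
  selectUpdate : Cell → (Fin (length tu) → Bool) → FTerm
  selectUpdate c b = maybe (proj₂ ∘ lookup tu) (cel c) (findᵇ b (TUc c))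

  selectUpdate-correct : ∀ {b c k τ} → ExactlyOneTrue b (TUc c) → lookup tu k ≡ (c , τ) →
                         b k ≡ true ⇔ selectUpdate c b ≡ τ
  selectUpdate-correct {b} {c} {k} {τ} one k↦cτ = mk⇔ selected selected⁻
    where
    k∈ : k ∈ TUc c
    k∈ = ∈-TUc⁺ (cong proj₁ k↦cτ)

    selected : b k ≡ true → selectUpdate c b ≡ τ
    selected bk rewrite findᵇ-exactlyOne b one k∈ bk = cong proj₂ k↦cτ

    selected⁻ : selectUpdate c b ≡ τ → b k ≡ true
    selected⁻ sel with findᵇ b (TUc c) in found
    ... | nothing = ⊥-elim (ExactlyOneTrue.¬none one (findᵇ-nothing⁻ b (TUc c) found))
    ... | just k′ =
      let k′∈ , bk′ = findᵇ-just⁻ b (TUc c) found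
          k′↦cτ = cong₂ _,_ (∈-TUc⁻ k′∈) sel
      in subst (λ k → b k ≡ true) (lookup-injective tu! k′ k (trans k′↦cτ (sym k↦cτ))) bk′

  strategy : L.LStrat → TStrat
  strategy σL n ws c = selectUpdate c (σL n ws)

  module Simulation (σL : L.LStrat) (I : Interp) where

    σT : TStrat
    σT = strategy σL

    trace : (ℕ → Input) → L.Trace
    trace ι = L.traceOf σL (letterStream σT I ι)

    comp-selects : ∀ ι i c → comp σT I ι i c ≡ selectUpdate c (updateOf (trace ι) i)
    comp-selects ι i c = cong (λ ws → σT i ws c) (letters-run σT I ι i)

    Corresponding : Exec → L.Trace → Set
    Corresponding e tr = Σ (ℕ → Input) λ ι → e ≡ execution σT I ι × tr ≡ trace ι

    atomP-correct : ∀ {e tr} → Corresponding e tr → ∀ i {k τ} →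
                    lookup tp k ≡ τ → tr i (inj₁ k) ≡ true ⇔ ηP I e i τ ≡ vtrue
    atomP-correct (ι , refl , refl) i {k} refl = letterStream-true⇔ σT I ι i k

    atomU-correct : ∀ {e tr} → Corresponding e tr → WellFormed tr → ∀ i {k c τ} →
                    lookup tu k ≡ (c , τ) → tr i (inj₂ k) ≡ true ⇔ proj₁ e i c ≡ τ
    atomU-correct (ι , refl , refl) wf i {c = c} k↦cτ
      rewrite comp-selects ι i c = selectUpdate-correct (wf i c) k↦cτ

    translB-correct : ∀ {n} (ψ : TBody n) (hp : ∀ {τ} → τ ∈ atomsPB ψ → τ ∈ tp)
                      (hu : ∀ {u} → u ∈ atomsUB ψ → u ∈ tu) → ∀ {ΠT ΠL} →
                      (∀ π → Corresponding (ΠT π) (ΠL π)) → (∀ π → WellFormed (ΠL π)) → ∀ i →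
                      L.⟦ translB ψ hp hu ⟧B ΠL i ⇔ ⟦ ψ ⟧B I ΠT i
    translB-correct (atomP τ π) hp hu corr wf i =
      atomP-correct (corr π) i (sym (lookup-index (hp (here refl))))
    translB-correct (atomU (c , τ) π) hp hu corr wf i =
      atomU-correct (corr π) (wf π) i (sym (lookup-index (hu (here refl))))
    translB-correct (neg ψ) hp hu corr wf i = ¬-cong-⇔ (translB-correct ψ hp hu corr wf i)
    translB-correct (and ψ₁ ψ₂) hp hu corr wf i =
      translB-correct ψ₁ _ _ corr wf i ×-⇔ translB-correct ψ₂ _ _ corr wf i
    translB-correct (X ψ) hp hu corr wf i = translB-correct ψ hp hu corr wf (suc i)
    translB-correct (U ψ₁ ψ₂) hp hu corr wf =
      until-cong (translB-correct ψ₁ _ _ corr wf) (translB-correct ψ₂ _ _ corr wf)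

    transl-sound : ∀ {n} {φ : TForm n} → Universal φ → (hp : ∀ {τ} → τ ∈ atomsP φ → τ ∈ tp)
                   (hu : ∀ {u} → u ∈ atomsU φ → u ∈ tu) → ∀ {ΠT ΠL} →
                   (∀ π → Corresponding (ΠT π) (ΠL π)) →
                   L.⟦ transl φ hp hu ⟧F (ℕ → Letter) (L.traceOf σL) ΠL →
                   ⟦ φ ⟧F I (ℕ → Input) (execution σT I) ΠT
    transl-sound {n} (body ψ) hp hu {ΠL = ΠL} corr (ψ′ , cells) =
      to (translB-correct ψ hp hu corr wf 0) ψ′
      where
      wf : ∀ π → WellFormed (ΠL π)
      wf π = cellProps⇒wellFormed π (⋀-map⁻ cellProps (allFin n) cells (∈-allFin π))
    transl-sound (all φ) hp hu {ΠT} {ΠL} corr ∀φ′ ι =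
      transl-sound φ hp hu corr′ (∀φ′ (letterStream σT I ι))
      where
      corr′ : ∀ π → Corresponding (ext (execution σT I ι) ΠT π) (L.ext (trace ι) ΠL π)
      corr′ zero = ι , refl , refl
      corr′ (suc π) = corr π

theorem1 : (S : Setting) → let open TSL S in
    (φ : TForm 0) → Universal φ →
    (tp : List PTerm) (tu : List UTerm) → Unique tp → Unique tu →
    (hp : ∀ {τ} → τ ∈ atomsP φ → τ ∈ tp) → (∀ {τ} → τ ∈ tp → τ ∈ atomsP φ) →
    (hu : ∀ {u} → u ∈ atomsU φ → u ∈ tu) → (∀ {u} → u ∈ tu → u ∈ atomsU φ) →
    LTLReal.LRealizable (Fin (length tp)) (Fin (length tu))
      (Transl.transl tp tu φ hp hu) →
    Real.TRealizable tp φ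
theorem1 S φ universal tp tu _ tu! hp _ hu _ (σL , realizes) =
  strategy σL , λ I →
    Simulation.transl-sound σL I universal hp hu (λ ()) realizes
  where open Translation S tp tu tu!
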